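{- Let $m,n$ be positive integers with $m\ge 4$ and $n\ge \frac{m(m-1)}{2}$. Assume that either $m$ is odd and $n\equiv 1 \pmod{m-2}$, or $m$ is even and $n\equiv \frac{m}{2}\pmod{m-2}$. Let \[c(n,m)=\frac{(m-3)n+m(m-1)/2}{m-2}\] (which is a positive integer under these hypotheses). Then every exact $c(n,m)$-coloring of $[1,n]$ admits a rainbow solution to $E_m$ in $[1,n]$.
   Context: For $m\ge 3$, $E_m$ denotes the equation $x_1+x_2+\cdots+x_{m-1}=x_m$. For a positive integer $n$, $[1,n]=\{1,2,\ldots,n\}$. An $r$-coloring of a set $S$ is a map $S\to\{1,\ldots,r\}$; it is exact if it is surjective. A solution to $E_m$ in $[1,n]$ is a tuple $(x_1,\ldots,x_m)$ of elements of $[1,n]$ satisfying $E_m$; under a coloring it is rainbow if the $m$ elements $x_1,\ldots,x_m$ receive pairwise distinct colors. -}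

module Defs where

open import Data.Nat using (ℕ; zero; suc; _+_; _*_; _∸_; _≤_)
open import Data.Nat.Divisibility using (_∣_)
open import Data.Fin using (Fin; fromℕ; inject₁) renaming (zero to fzero; suc to fsuc)
open import Data.Product using (_×_; ∃-syntax)
open import Relation.Binary.PropositionalEquality using (_≡_)
open import Function.Base using (_∘_)
open import Function.Definitions using (Injective)

-- a ≡ b (mod d), for natural numbers (truncated subtraction makes one of
-- the two divisibilities trivial; together: d divides |a - b|)
_≡_[mod_] : ℕ → ℕ → ℕ → Set
a ≡ b [mod d ] = (d ∣ (a ∸ b)) × (d ∣ (b ∸ a))

InRange : ℕ → ℕ → Set
InRange n x = (1 ≤ x) × (x ≤ n)

-- An r-coloring of [1,n]: a function ℕ → Fin r of which only the values on
-- [1,n] matter (colors are 0..r-1 instead of 1..r).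
Coloring : ℕ → Set
Coloring r = ℕ → Fin r

Exact : (n r : ℕ) → Coloring r → Set
Exact n r χ = (k : Fin r) → ∃[ x ] (InRange n x × χ x ≡ k)

sumFin : (k : ℕ) → (Fin k → ℕ) → ℕ
sumFin zero    f = 0
sumFin (suc k) f = f fzero + sumFin k (f ∘ fsuc)

-- A solution of E_m (m = suc k) in [1,n]: a tuple x : Fin m → ℕ with all
-- entries in [1,n] and x_1 + ... + x_{m-1} = x_m (last index = fromℕ k).
SolutionE : (k n : ℕ) → (Fin (suc k) → ℕ) → Set
SolutionE k n x =
  ((i : Fin (suc k)) → InRange n (x i)) ×
  (sumFin k (x ∘ inject₁) ≡ x (fromℕ k))

Rainbow : {r k : ℕ} → Coloring r → (Fin (suc k) → ℕ) → Set
Rainbow χ x = Injective _≡_ _≡_ (χ ∘ x)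

{-# OPTIONS --safe #-}
-- Scan [1,n] from the left, recording the first point of each new colour, until m − 2
-- colours have appeared, at points 1 = s₁ < ⋯ < s_{m−2} = u (there are enough colours,
-- since c ≥ m(m−1)/2). Let σ = s₁ + ⋯ + s_{m−2}; every other colour κ occurs only beyond u,
-- say at y_κ. If y_κ = y_κ′ + σ for two such colours, then s₁ + ⋯ + s_{m−2} + y_κ′ = y_κ
-- is a rainbow solution. Otherwise the 2(c − m + 2) numbers y_κ and y_κ + σ are distinct
-- elements of (u, n + σ], which together with c − m + 2 ≤ n − u,
-- σ ≤ 1 + (m−3)u − (m−3)(m−4)/2 and (m−2)c = (m−3)n + m(m−1)/2 is impossible.
module Submission where

open import Defs
open import Data.Empty using (⊥-elim)
open import Data.Fin using (Fin; toℕ; fromℕ; fromℕ<; inject₁; punchIn; punchOut; splitAt; join)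
  renaming (zero to fzero; suc to fsuc)
import Data.Fin.Properties as Finₚ
open import Data.Nat using (ℕ; zero; suc; _+_; _*_; _∸_; _/_; _≤_; _<_; _≤?_; z≤n; s≤s; s≤s⁻¹)
open import Data.Nat.Divisibility using (_∣_)
open import Data.Nat.DivMod using (m*n/n≡m)
open import Data.Nat.Properties
open import Data.Nat.Tactic.RingSolver using (solve-∀)
open import Data.Product using (_×_; _,_; proj₁; proj₂; curry; ∃-syntax; ∃₂)
open import Data.Sum using (_⊎_; inj₁; inj₂; [_,_])
open import Data.Vec.Functional using (Vector; insertAt)
open import Data.Vec.Functional.Properties using (insertAt-lookup; insertAt-punchIn)
open import Function.Base using (_∘_; id)
open import Function.Definitions using (Injective)
open import Relation.Nullary using (¬_; yes; no)
open import Relation.Binary.PropositionalEquality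
  using (_≡_; _≢_; refl; sym; trans; cong; cong₂; subst; module ≡-Reasoning)

triangle : ℕ → ℕ
triangle zero    = 0
triangle (suc j) = suc j + triangle j

triangle-double : ∀ j → triangle j * 2 ≡ j * suc j
triangle-double zero    = refl
triangle-double (suc j) = begin
  (suc j + t) * 2          ≡⟨ regroup j t ⟩
  t * 2 + 2 * suc j        ≡⟨ cong (_+ 2 * suc j) (triangle-double j) ⟩
  j * suc j + 2 * suc j    ≡⟨ regroup′ j ⟩
  suc j * suc (suc j)      ∎
  where
  open ≡-Reasoning
  t : ℕ
  t = triangle j
  regroup : ∀ j t → (suc j + t) * 2 ≡ t * 2 + 2 * suc j
  regroup = solve-∀
  regroup′ : ∀ j → j * suc j + 2 * suc j ≡ suc j * suc (suc j)
  regroup′ = solve-∀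

triangle-closed : ∀ j → suc j * j / 2 ≡ triangle j
triangle-closed j = begin
  suc j * j / 2        ≡⟨ cong (_/ 2) (*-comm (suc j) j) ⟩
  j * suc j / 2        ≡⟨ cong (_/ 2) (triangle-double j) ⟨
  triangle j * 2 / 2   ≡⟨ m*n/n≡m (triangle j) 2 ⟩
  triangle j           ∎
  where open ≡-Reasoning

≤-from-weighted-mean : ∀ k {c n t} → t ≤ n → suc k * c ≡ k * n + t → t ≤ c
≤-from-weighted-mean k {c} {n} {t} t≤n eq = *-cancelˡ-≤ (suc k) (begin
  suc k * t   ≡⟨ +-comm t (k * t) ⟩
  k * t + t   ≤⟨ +-monoˡ-≤ t (*-monoʳ-≤ k t≤n) ⟩
  k * n + t   ≡⟨ eq ⟨
  suc k * c   ∎)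
  where open ≤-Reasoning

sumFin-cong : ∀ k {f g : Fin k → ℕ} → (∀ i → f i ≡ g i) → sumFin k f ≡ sumFin k g
sumFin-cong zero    f≗g = refl
sumFin-cong (suc k) f≗g = cong₂ _+_ (f≗g fzero) (sumFin-cong k (f≗g ∘ fsuc))

punchIn-fromℕ : ∀ n (i : Fin n) → punchIn (fromℕ n) i ≡ inject₁ i
punchIn-fromℕ (suc n) fzero    = refl
punchIn-fromℕ (suc n) (fsuc i) = cong fsuc (punchIn-fromℕ n i)

≡⊎punchIn : ∀ {n} (i j : Fin (suc n)) → i ≡ j ⊎ ∃[ j′ ] punchIn i j′ ≡ j
≡⊎punchIn i j with i Finₚ.≟ j
... | yes i≡j = inj₁ i≡j
... | no  i≢j = inj₂ (punchOut i≢j , Finₚ.punchIn-punchOut i≢j)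

module _ {A : Set} {n} {xs : Vector A n} (i : Fin (suc n)) {v : A} where

  insertAt-all : (P : A → Set) → P v → (∀ j → P (xs j)) → ∀ j → P (insertAt xs i v j)
  insertAt-all P Pv Pxs j with ≡⊎punchIn i j
  ... | inj₁ refl        = subst P (sym (insertAt-lookup xs i v)) Pv
  ... | inj₂ (j′ , refl) = subst P (sym (insertAt-punchIn xs i v j′)) (Pxs j′)

  module _ {B : Set} (f : A → B) where

    private
      at-i : f (insertAt xs i v i) ≡ f v
      at-i = cong f (insertAt-lookup xs i v)

      off-i : ∀ j → f (insertAt xs i v (punchIn i j)) ≡ f (xs j)
      off-i j = cong f (insertAt-punchIn xs i v j)

    insertAt-injective : Injective _≡_ _≡_ (f ∘ xs) → (∀ j → f v ≢ f (xs j)) →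
                         Injective _≡_ _≡_ (f ∘ insertAt xs i v)
    insertAt-injective inj fresh {j₁} {j₂} eq with ≡⊎punchIn i j₁ | ≡⊎punchIn i j₂
    ... | inj₁ refl         | inj₁ refl         = refl
    ... | inj₁ refl         | inj₂ (j′ , refl)  = ⊥-elim (fresh j′ (trans (sym at-i) (trans eq (off-i j′))))
    ... | inj₂ (j′ , refl)  | inj₁ refl         = ⊥-elim (fresh j′ (trans (sym at-i) (trans (sym eq) (off-i j′))))
    ... | inj₂ (j₁′ , refl) | inj₂ (j₂′ , refl) =
      cong (punchIn i) (inj (trans (sym (off-i j₁′)) (trans eq (off-i j₂′))))

module _ {a b : ℕ} (f : Fin a → ℕ) (f<b : ∀ i → f i < b) where

  private
    f′ : Fin a → Fin b
    f′ i = fromℕ< (f<b i)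

    f′≡→f≡ : ∀ {i j} → f′ i ≡ f′ j → f i ≡ f j
    f′≡→f≡ {i} {j} eq =
      trans (sym (Finₚ.toℕ-fromℕ< (f<b i))) (trans (cong toℕ eq) (Finₚ.toℕ-fromℕ< (f<b j)))

  bounded-injective⇒≤ : Injective _≡_ _≡_ f → a ≤ b
  bounded-injective⇒≤ inj = Finₚ.injective⇒≤ (inj ∘ f′≡→f≡)

  bounded-pigeonhole : b < a → ∃₂ λ i j → i ≢ j × f i ≡ f j
  bounded-pigeonhole b<a with Finₚ.pigeonhole b<a f′
  ... | i , j , i<j , eq = i , j , Finₚ.<⇒≢ i<j , f′≡→f≡ eq

InRange-weaken : ∀ {u v x} → u ≤ v → InRange u x → InRange v x
InRange-weaken u≤v (1≤x , x≤u) = 1≤x , ≤-trans x≤u u≤v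

InRange-suc⁻ : ∀ {u x} → InRange (suc u) x → InRange u x ⊎ x ≡ suc u
InRange-suc⁻ (1≤x , x≤1+u) with m≤n⇒m<n∨m≡n x≤1+u
... | inj₁ x<1+u = inj₁ (1≤x , s≤s⁻¹ x<1+u)
... | inj₂ x≡1+u = inj₂ x≡1+u

module Greedy {c : ℕ} (χ : Coloring c) where

  -- The points are 1 and j further distinct elements of [2,u], whence the sum bound.
  record Palette (u j : ℕ) : Set where
    field
      pts       : Vector ℕ (suc j)
      pts-in    : ∀ i → InRange u (pts i)
      rainbow   : Injective _≡_ _≡_ (χ ∘ pts)
      covers    : ∀ x → InRange u x → ∃[ i ] χ x ≡ χ (pts i)
      sum-bound : sumFin (suc j) pts + triangle j ≤ 1 + j * suc u

  palette₁ : Palette 1 0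
  palette₁ = record
    { pts       = λ _ → 1
    ; pts-in    = λ _ → ≤-refl , ≤-refl
    ; rainbow   = λ { {fzero} {fzero} _ → refl }
    ; covers    = λ { x (1≤x , x≤1) → fzero , cong χ (≤-antisym x≤1 1≤x) }
    ; sum-bound = ≤-refl
    }

  module _ {u j} (P : Palette u j) where
    open Palette P

    extend-seen : ∃[ i ] χ (suc u) ≡ χ (pts i) → Palette (suc u) j
    extend-seen seen = record
      { pts       = pts
      ; pts-in    = InRange-weaken (n≤1+n u) ∘ pts-in
      ; rainbow   = rainbow
      ; covers    = covers′
      ; sum-bound = ≤-trans sum-bound (+-monoʳ-≤ 1 (*-monoʳ-≤ j (n≤1+n (suc u))))
      }
      where
      covers′ : ∀ x → InRange (suc u) x → ∃[ i ] χ x ≡ χ (pts i)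
      covers′ x x∈ with InRange-suc⁻ x∈
      ... | inj₁ x∈′ = covers x x∈′
      ... | inj₂ refl = seen

    extend-unseen : (∀ i → χ (suc u) ≢ χ (pts i)) → Palette (suc u) (suc j)
    extend-unseen fresh = record
      { pts       = insertAt pts fzero (suc u)
      ; pts-in    = insertAt-all fzero (InRange (suc u)) (s≤s z≤n , ≤-refl)
                                 (InRange-weaken (n≤1+n u) ∘ pts-in)
      ; rainbow   = insertAt-injective fzero χ rainbow fresh
      ; covers    = covers′
      ; sum-bound = bound-step sum-bound
      }
      where
      covers′ : ∀ x → InRange (suc u) x → ∃[ i ] χ x ≡ χ (insertAt pts fzero (suc u) i)
      covers′ x x∈ with InRange-suc⁻ x∈
      ... | inj₁ x∈′ = fsuc (proj₁ (covers x x∈′)) , proj₂ (covers x x∈′)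
      ... | inj₂ refl = fzero , refl

      bound-step : ∀ {σ t} → σ + t ≤ 1 + j * suc u → (suc u + σ) + (suc j + t) ≤ 1 + suc j * suc (suc u)
      bound-step {σ} {t} h = begin
        (suc u + σ) + (suc j + t)         ≡⟨ regroup u j σ t ⟩
        (σ + t) + (suc u + suc j)         ≤⟨ +-monoˡ-≤ (suc u + suc j) h ⟩
        (1 + j * suc u) + (suc u + suc j) ≡⟨ regroup′ u j ⟩
        1 + suc j * suc (suc u)           ∎
        where
        open ≤-Reasoning
        regroup : ∀ u j σ t → (suc u + σ) + (suc j + t) ≡ (σ + t) + (suc u + suc j)
        regroup = solve-∀
        regroup′ : ∀ u j → (1 + j * suc u) + (suc u + suc j) ≡ 1 + suc j * suc (suc u)
        regroup′ = solve-∀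

  grow : ∀ {t} u → 1 ≤ u → (∃[ u′ ] u′ ≤ u × Palette u′ (suc t)) ⊎ (∃[ j ] j ≤ t × Palette u j)
  grow (suc zero)    _ = inj₂ (0 , z≤n , palette₁)
  grow (suc (suc u)) _ with grow (suc u) (s≤s z≤n)
  ... | inj₁ (u′ , u′≤u , P) = inj₁ (u′ , m≤n⇒m≤1+n u′≤u , P)
  ... | inj₂ (j , j≤t , P) with Finₚ.any? (λ i → χ (suc (suc u)) Finₚ.≟ χ (Palette.pts P i))
  ...   | yes seen = inj₂ (j , j≤t , extend-seen P seen)
  ...   | no unseen with m≤n⇒m<n∨m≡n j≤t
  ...     | inj₁ j<t  = inj₂ (suc j , j<t , extend-unseen P (curry unseen))
  ...     | inj₂ refl = inj₁ (suc (suc u) , ≤-refl , extend-unseen P (curry unseen))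

module Representatives {n c : ℕ} (χ : Coloring c) (exact : Exact n c χ) where
  open Greedy χ

  RainbowSolution : ℕ → Set
  RainbowSolution k = ∃[ x ] (SolutionE k n x × Rainbow χ x)

  rep : Fin c → ℕ
  rep κ = proj₁ (exact κ)

  rep-in : ∀ κ → InRange n (rep κ)
  rep-in κ = proj₁ (proj₂ (exact κ))

  χ-rep : ∀ κ → χ (rep κ) ≡ κ
  χ-rep κ = proj₂ (proj₂ (exact κ))

  χ∘rep-injective : Injective _≡_ _≡_ (χ ∘ rep)
  χ∘rep-injective {κ} {κ′} eq = trans (sym (χ-rep κ)) (trans eq (χ-rep κ′))

  colours≤palette-size : ∀ {j} → Palette n j → c ≤ suc j
  colours≤palette-size {j} P = Finₚ.injective⇒≤ {f = index} index-injective
    where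
    open Palette P
    index : Fin c → Fin (suc j)
    index κ = proj₁ (covers (rep κ) (rep-in κ))
    index-injective : Injective _≡_ _≡_ index
    index-injective {κ} {κ′} eq = χ∘rep-injective (begin
      χ (rep κ)          ≡⟨ proj₂ (covers (rep κ) (rep-in κ)) ⟩
      χ (pts (index κ))  ≡⟨ cong (χ ∘ pts) eq ⟩
      χ (pts (index κ′)) ≡⟨ proj₂ (covers (rep κ′) (rep-in κ′)) ⟨
      χ (rep κ′)         ∎)
      where open ≡-Reasoning

  module Saturated {u j} (u≤n : u ≤ n) (P : Palette u j) where
    open Palette P

    σ : ℕ
    σ = sumFin (suc j) pts

    Unseen : Fin c → Set
    Unseen κ = ∀ i → χ (pts i) ≢ κ

    classify : ∀ κ → (∃[ i ] χ (pts i) ≡ κ) ⊎ Unseen κ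
    classify κ with Finₚ.any? (λ i → χ (pts i) Finₚ.≟ κ)
    ... | yes seen  = inj₁ seen
    ... | no unseen = inj₂ (curry unseen)

    unseen-rep-beyond : ∀ {κ} → Unseen κ → u < rep κ
    unseen-rep-beyond {κ} unseen with rep κ ≤? u
    ... | no rep≰u  = ≰⇒> rep≰u
    ... | yes rep≤u = let (i , eq) = covers (rep κ) (proj₁ (rep-in κ) , rep≤u)
                      in ⊥-elim (unseen i (trans (sym eq) (χ-rep κ)))

    Shifted : Fin c → Fin c → Set
    Shifted κ κ′ = Unseen κ × Unseen κ′ × rep κ ≡ rep κ′ + σ

    rainbow-solution : ∀ {κ κ′} → Shifted κ κ′ → RainbowSolution (suc (suc j))
    rainbow-solution {κ} {κ′} (unseen , unseen′ , shift) = x , (x-in , x-sum) , x-rainbow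
      where
      open ≡-Reasoning
      front : Vector ℕ (suc (suc j))
      front = insertAt pts fzero (rep κ′)

      last : Fin (suc (suc (suc j)))
      last = fromℕ (suc (suc j))

      x : Vector ℕ (suc (suc (suc j)))
      x = insertAt front last (rep κ)

      x-in : ∀ i → InRange n (x i)
      x-in = insertAt-all last (InRange n) (rep-in κ)
               (insertAt-all fzero (InRange n) (rep-in κ′) (InRange-weaken u≤n ∘ pts-in))

      x-sum : sumFin (suc (suc j)) (x ∘ inject₁) ≡ x last
      x-sum = begin
        sumFin (suc (suc j)) (x ∘ inject₁) ≡⟨ sumFin-cong (suc (suc j)) x∘inject₁≗front ⟩
        rep κ′ + σ                         ≡⟨ shift ⟨
        rep κ                              ≡⟨ insertAt-lookup front last (rep κ) ⟨
        x last                             ∎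
        where
        x∘inject₁≗front : ∀ i → x (inject₁ i) ≡ front i
        x∘inject₁≗front i = trans (cong x (sym (punchIn-fromℕ (suc (suc j)) i)))
                                  (insertAt-punchIn front last (rep κ) i)

      κ≢κ′ : κ ≢ κ′
      κ≢κ′ refl = <⇒≢ (m<m+n (rep κ) (≤-trans (proj₁ (pts-in fzero)) (m≤m+n _ _))) shift

      fresh′ : ∀ i → χ (rep κ′) ≢ χ (pts i)
      fresh′ i eq = unseen′ i (trans (sym eq) (χ-rep κ′))

      fresh : ∀ i → χ (rep κ) ≢ χ (front i)
      fresh fzero    eq = κ≢κ′ (χ∘rep-injective eq)
      fresh (fsuc i) eq = unseen i (trans (sym eq) (χ-rep κ))

      x-rainbow : Rainbow χ x
      x-rainbow = insertAt-injective last χ (insertAt-injective fzero χ rainbow fresh′) fresh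

    K : ℕ
    K = suc j

    K+K≤K+K+σ : K + K ≤ K + K + σ
    K+K≤K+K+σ = m≤m+n (K + K) σ

    slot : ℕ → ℕ → Fin c → ℕ
    slot a b κ with classify κ
    ... | inj₁ (i , _) = a + toℕ i
    ... | inj₂ _       = b + (rep κ ∸ suc u)

    private
      packed<shifted : ∀ {a b} z → a + K ≤ b → (i : Fin K) → a + toℕ i < b + z
      packed<shifted {a} {b} z a+K≤b i =
        <-≤-trans (+-monoʳ-< a (Finₚ.toℕ<n i)) (≤-trans a+K≤b (m≤m+n b z))

    slot-< : ∀ {a b} → a + K ≤ b → ∀ κ → slot a b κ < b + (n ∸ u)
    slot-< a+K≤b κ with classify κ
    ... | inj₁ (i , _) = packed<shifted _ a+K≤b i
    ... | inj₂ unseen  = +-monoʳ-< _ (∸-monoˡ-< (s≤s (proj₂ (rep-in κ))) (unseen-rep-beyond unseen))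

    slot-injective : ∀ {a b} → a + K ≤ b → Injective _≡_ _≡_ (slot a b)
    slot-injective {a} {b} a+K≤b {κ} {κ′} eq with classify κ | classify κ′
    ... | inj₁ (i , χi≡κ) | inj₁ (i′ , χi′≡κ′) =
      trans (sym χi≡κ) (trans (cong (χ ∘ pts) (Finₚ.toℕ-injective (+-cancelˡ-≡ a _ _ eq))) χi′≡κ′)
    ... | inj₁ (i , _) | inj₂ _        = ⊥-elim (<⇒≢ (packed<shifted _ a+K≤b i) eq)
    ... | inj₂ _       | inj₁ (i′ , _) = ⊥-elim (<⇒≢ (packed<shifted _ a+K≤b i′) (sym eq))
    ... | inj₂ unseen  | inj₂ unseen′  = χ∘rep-injective (cong χ
      (∸-cancelʳ-≡ (unseen-rep-beyond unseen) (unseen-rep-beyond unseen′) (+-cancelˡ-≡ b _ _ eq)))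

    slot-collision : ∀ {κ κ′} → slot 0 (K + K) κ ≡ slot K (K + K + σ) κ′ → Shifted κ κ′
    slot-collision {κ} {κ′} eq with classify κ | classify κ′
    ... | inj₁ (i , _) | inj₁ (i′ , _) = ⊥-elim (<⇒≢ (packed<shifted _ ≤-refl i) eq)
    ... | inj₁ (i , _) | inj₂ _        = ⊥-elim (<⇒≢ (packed<shifted _ (≤-trans (m≤m+n K K) K+K≤K+K+σ) i) eq)
    ... | inj₂ _       | inj₁ (i′ , _) = ⊥-elim (<⇒≢ (packed<shifted _ ≤-refl i′) (sym eq))
    ... | inj₂ unseen  | inj₂ unseen′  = unseen , unseen′ , trans shifted (+-comm σ (rep κ′))
      where
      open ≡-Reasoning
      u<repκ′ : u < rep κ′
      u<repκ′ = unseen-rep-beyond unseen′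
      shifted : rep κ ≡ σ + rep κ′
      shifted = ∸-cancelʳ-≡ (unseen-rep-beyond unseen) (≤-trans u<repκ′ (m≤n+m _ σ)) (begin
        rep κ ∸ suc u          ≡⟨ +-cancelˡ-≡ (K + K) _ _ (trans eq (+-assoc (K + K) σ _)) ⟩
        σ + (rep κ′ ∸ suc u)   ≡⟨ +-∸-assoc σ u<repκ′ ⟨
        σ + rep κ′ ∸ suc u     ∎)

    colours≤size+gap : c ≤ K + (n ∸ u)
    colours≤size+gap = bounded-injective⇒≤ (slot 0 K) (slot-< ≤-refl) (slot-injective ≤-refl)

    rainbow-if-crowded : K + K + σ + (n ∸ u) < c + c → RainbowSolution (suc K)
    rainbow-if-crowded crowded =
      let p , q , p≢q , eq = bounded-pigeonhole (H ∘ splitAt c) (H-< ∘ splitAt c) crowded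
      in [ (λ same → ⊥-elim (p≢q (splitAt-injective same))) , id ] (H-collision _ _ eq)
      where
      H : Fin c ⊎ Fin c → ℕ
      H = [ slot 0 (K + K) , slot K (K + K + σ) ]

      H-< : ∀ s → H s < K + K + σ + (n ∸ u)
      H-< (inj₁ κ) = <-≤-trans (slot-< (m≤m+n K K) κ) (+-monoˡ-≤ (n ∸ u) K+K≤K+K+σ)
      H-< (inj₂ κ) = slot-< K+K≤K+K+σ κ

      H-collision : ∀ s t → H s ≡ H t → s ≡ t ⊎ RainbowSolution (suc K)
      H-collision (inj₁ κ) (inj₁ κ′) eq = inj₁ (cong inj₁ (slot-injective (m≤m+n K K) eq))
      H-collision (inj₁ κ) (inj₂ κ′) eq = inj₂ (rainbow-solution (slot-collision eq))
      H-collision (inj₂ κ) (inj₁ κ′) eq = inj₂ (rainbow-solution (slot-collision (sym eq)))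
      H-collision (inj₂ κ) (inj₂ κ′) eq = inj₁ (cong inj₂ (slot-injective K+K≤K+K+σ eq))

      splitAt-injective : ∀ {p q} → splitAt c p ≡ splitAt c q → p ≡ q
      splitAt-injective {p} {q} eq =
        trans (sym (Finₚ.join-splitAt c c p)) (trans (cong (join c c) eq) (Finₚ.join-splitAt c c q))

crowding : ∀ k {c g u σ} → c ≤ (2 + k) + g → σ + triangle (1 + k) ≤ 1 + (1 + k) * (1 + u) →
           (2 + k) * c ≡ (1 + k) * (g + u) + triangle (3 + k) →
           (2 + k) + (2 + k) + σ + g < c + c
crowding k {c} {g} {u} {σ} c≤K+g σ-bound eq = ≰⇒> λ not-crowded →
  1+n≰n (subst (_≤ R) (lhs≡1+R) (lhs≤R not-crowded))
  where
  open ≤-Reasoning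
  t N R : ℕ
  t = triangle (1 + k)
  N = (1 + k) * (g + u)
  R = (2 + k) * (2 + k) + N + (2 + k)

  lhs≤R : c + c ≤ (2 + k) + (2 + k) + σ + g → (2 + k) * c + t ≤ R
  lhs≤R c+c≤ = begin
    (2 + k) * c + t                                              ≡⟨ split-c k c t ⟩
    (c + c) + k * c + t                                          ≤⟨ +-monoˡ-≤ t (+-mono-≤ c+c≤ (*-monoʳ-≤ k c≤K+g)) ⟩
    ((2 + k) + (2 + k) + σ + g) + k * ((2 + k) + g) + t          ≡⟨ collect k g σ t ⟩
    (2 + k) * (2 + k) + (1 + k) * g + (σ + t)                    ≤⟨ +-monoʳ-≤ _ σ-bound ⟩
    (2 + k) * (2 + k) + (1 + k) * g + (1 + (1 + k) * (1 + u))    ≡⟨ collect′ k g u ⟩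
    R                                                            ∎
    where
    split-c : ∀ k c t → (2 + k) * c + t ≡ (c + c) + k * c + t
    split-c = solve-∀
    collect : ∀ k g σ t → ((2 + k) + (2 + k) + σ + g) + k * ((2 + k) + g) + t
                          ≡ (2 + k) * (2 + k) + (1 + k) * g + (σ + t)
    collect = solve-∀
    collect′ : ∀ k g u → (2 + k) * (2 + k) + (1 + k) * g + (1 + (1 + k) * (1 + u))
                         ≡ (2 + k) * (2 + k) + (1 + k) * (g + u) + (2 + k)
    collect′ = solve-∀

  lhs≡1+R : (2 + k) * c + t ≡ suc R
  lhs≡1+R = begin-equality
    (2 + k) * c + t                        ≡⟨ cong (_+ t) eq ⟩
    N + triangle (3 + k) + t               ≡⟨ unfold k N t ⟩
    N + (5 + 2 * k) + t * 2                ≡⟨ cong (N + (5 + 2 * k) +_) (triangle-double (1 + k)) ⟩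
    N + (5 + 2 * k) + (1 + k) * (2 + k)    ≡⟨ collect k (g + u) ⟩
    suc R                                  ∎
    where
    unfold : ∀ k N t → N + ((3 + k) + ((2 + k) + t)) + t ≡ N + (5 + 2 * k) + t * 2
    unfold = solve-∀
    collect : ∀ k N → (1 + k) * N + (5 + 2 * k) + (1 + k) * (2 + k)
                      ≡ suc ((2 + k) * (2 + k) + (1 + k) * N + (2 + k))
    collect = solve-∀

-- The congruence condition on n only makes c(n,m) an integer; here c is given
-- through (m − 2)c = (m − 3)n + m(m − 1)/2.
theorem4 : (m n c : ℕ) → 4 ≤ m → 1 ≤ n → m * (m ∸ 1) / 2 ≤ n →
    ((¬ (2 ∣ m) × n ≡ 1 [mod m ∸ 2 ]) ⊎ ((2 ∣ m) × n ≡ m / 2 [mod m ∸ 2 ])) →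
    (m ∸ 2) * c ≡ (m ∸ 3) * n + m * (m ∸ 1) / 2 →
    (χ : Coloring c) → Exact n c χ →
    ∃[ x ] (SolutionE (m ∸ 1) n x × Rainbow χ x)
theorem4 _ n c (s≤s (s≤s (s≤s (s≤s (z≤n {k}))))) 1≤n m[m∸1]/2≤n _ ceq χ exact =
  [ saturated , too-few-colours ] (grow n 1≤n)
  where
  open Greedy χ
  open Representatives χ exact

  m[m∸1]/2≡ : (4 + k) * (3 + k) / 2 ≡ triangle (3 + k)
  m[m∸1]/2≡ = triangle-closed (3 + k)

  ceq′ : (2 + k) * c ≡ (1 + k) * n + triangle (3 + k)
  ceq′ = trans ceq (cong ((1 + k) * n +_) m[m∸1]/2≡)

  2+k≤c : 2 + k ≤ c
  2+k≤c = ≤-trans (≤-trans (n≤1+n (2 + k)) (m≤m+n (3 + k) _))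
                  (≤-from-weighted-mean (1 + k) (subst (_≤ n) m[m∸1]/2≡ m[m∸1]/2≤n) ceq′)

  too-few-colours : ∃[ j ] j ≤ k × Palette n j → RainbowSolution (3 + k)
  too-few-colours (j , j≤k , P) =
    ⊥-elim (1+n≰n (≤-trans 2+k≤c (≤-trans (colours≤palette-size P) (s≤s j≤k))))

  saturated : ∃[ u ] u ≤ n × Palette u (1 + k) → RainbowSolution (3 + k)
  saturated (u , u≤n , P) = rainbow-if-crowded (crowding k colours≤size+gap sum-bound ceq″)
    where
    open Palette P
    open Saturated u≤n P
    ceq″ : (2 + k) * c ≡ (1 + k) * ((n ∸ u) + u) + triangle (3 + k)
    ceq″ = subst (λ n′ → (2 + k) * c ≡ (1 + k) * n′ + triangle (3 + k)) (sym (m∸n+n≡m u≤n)) ceq′
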